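{- Let $G$ be the GRETA graph for a query $q$ (with positive Kleene pattern $P$) and an event stream $I$, let $E$ be an event type, let $attr$ be a numeric attribute of events of type $E$, and let $End$ be the set of END events of $G$. For each vertex $e$ of $G$ let $Pr(e)$ be its set of predecessor events and $e.count$ the number of directed paths in $G$ from a START vertex to $e$. Define, for every vertex $e$ (in increasing order of time): if $e.type=E$: $e.count_E = e.count+\sum_{p\in Pr(e)} p.count_E$, $e.min=\min(\{e.attr\}\cup\{p.min : p\in Pr(e)\})$, $e.max=\max(\{e.attr\}\cup\{p.max : p\in Pr(e)\})$, $e.sum = e.attr\cdot e.count+\sum_{p\in Pr(e)} p.sum$; if $e.type\ne E$: $e.count_E=\sum_{p\in Pr(e)} p.count_E$, $e.min=\min_{p\in Pr(e)} p.min$, $e.max=\max_{p\in Pr(e)} p.max$, $e.sum=\sum_{p\in Pr(e)} p.sum$ (with $\min\emptyset=+\infty$, $\max\emptyset=-\infty$, empty sums $0$). Then, where the trends captured by $G$ are its directed paths from a START vertex to an END vertex: $\textsf{COUNT}(E)=\sum_{end\in End} end.count_E$ is the total number of occurrences of events of type $E$ over all trends captured by $G$; $\textsf{MIN}(E.attr)=\min_{end\in End} end.min$ and $\textsf{MAX}(E.attr)=\max_{end\in End} end.max$ are the minimal, respectively maximal, value of $attr$ over all events of type $E$ in all trends captured by $G$; $\textsf{SUM}(E.attr)=\sum_{end\in End} end.sum$ is the sum, over all trends captured by $G$, of the values of $attr$ of the events of type $E$ in the trend (counted with multiplicity across trends); $\textsf{AVG}(E.attr)=\textsf{SUM}(E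.attr)/\textsf{COUNT}(E)$.
   Context: Events have an event type, an occurrence time and attribute values; the stream $I$ is a sequence of events arriving in increasing order of time. Positive patterns are built from event types by $\textsf{SEQ}(P_i,P_j)$ (a match of $P_i$ followed by a match of $P_j$, times strictly increasing) and $P_i+$ (a concatenation of one or more matches of $P_i$, each ending strictly before the next starts). Two events are adjacent in a matched trend if they are consecutive in it. $start(P)$ is the first event type of $P$ ($start(E)=E$, $start(P_i+)=start(P_i)$, $start(\textsf{SEQ}(P_i,P_j))=start(P_i)$) and $end(P)$ the last ($end(E)=E$, $end(P_i+)=end(P_i)$, $end(\textsf{SEQ}(P_i,P_j))=end(P_j)$). A query $q$ consists of a pattern $P$ together with predicates, grouping attributes and a window; a trend matched by $q$ is an event sequence of $I$ matched by $P$ whose events satisfy the predicates, lie in the same window and have equal grouping attribute values. The GRETA graph $G$ of $q$ and $I$ has as vertices the events of $I$ matched by $q$ and an edge $(v_i,v_j)$ whenever $v_i,v_j$ are adjacent in some trend matched by $q$ (edges go forward in time, so $G$ is acyclic); $v_i$ is a predecessor event of $v_j$. START events are vertices of type $start(P)$, END events are vertices of type $end(P)$. The aggregates $\textsf{COUNT}(E)$, $\textsf{MIN}(E.attr)$, $\textsf{MAX}(E.attr)$, $\textsf{SUM}(E.attr)$, $\textsf{AVG}(E.attr)$ of a set of trends are, respectively, the number of events of type $E$ in all trends, the minimum and maximum of $attr$ over events of type $E$ in all trends, the sum of $attr$ over events of type $E$ in all trends, and $\textsf{SUM}/\textsf{COUNT}$. -}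

module Defs where

open import Data.Nat as ℕ using (ℕ; zero; suc; _<_; _≡ᵇ_)
open import Data.Bool using (Bool; true; false; T; if_then_else_)
open import Data.Integer using (+_)
open import Data.Rational as ℚ using (ℚ; 0ℚ; _/_)
open import Data.Maybe using (Maybe; just; nothing)
open import Data.List using (List; []; _∷_; map; foldr; filterᵇ; upTo)
open import Data.List.Relation.Unary.All using (All)
open import Data.List.Relation.Unary.Linked using (Linked)
open import Data.Empty using (⊥)
open import Data.Product using (_×_)

-- Vertices are the matched events, numbered 0 … n-1 in increasing order
-- of occurrence time.

record Graph : Set where
  field
    n       : ℕ
    type    : ℕ → ℕ
    attr    : ℕ → ℚ
    isStart : ℕ → Bool
    isEnd   : ℕ → Bool
    edge    : ℕ → ℕ → Bool
    edge-forward : ∀ {i j} → T (edge i j) → i < j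
    edge-bound   : ∀ {i j} → T (edge i j) → j < n

module _ (G : Graph) where
  open Graph G

  Edge : ℕ → ℕ → Set
  Edge i j = T (edge i j)

  lastOf : ℕ → List ℕ → ℕ
  lastOf v []       = v
  lastOf _ (w ∷ ws) = lastOf w ws

  IsTrend : List ℕ → Set
  IsTrend []       = ⊥
  IsTrend (v ∷ vs) =
    T (isStart v) × T (isEnd (lastOf v vs)) × All (_< n) (v ∷ vs) × Linked Edge (v ∷ vs)

-- extended min / max  (nothing = +∞ for min, nothing = -∞ for max)

minM : Maybe ℚ → Maybe ℚ → Maybe ℚ
minM nothing  y        = y
minM (just x) nothing  = just x
minM (just x) (just y) = just (x ℚ.⊓ y)

maxM : Maybe ℚ → Maybe ℚ → Maybe ℚ
maxM nothing  y        = y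
maxM (just x) nothing  = just x
maxM (just x) (just y) = just (x ℚ.⊔ y)

sumℕ : List ℕ → ℕ
sumℕ = foldr ℕ._+_ 0

sumℚ : List ℚ → ℚ
sumℚ = foldr ℚ._+_ 0ℚ

minL : List (Maybe ℚ) → Maybe ℚ
minL = foldr minM nothing

maxL : List (Maybe ℚ) → Maybe ℚ
maxL = foldr maxM nothing

fromℕℚ : ℕ → ℚ
fromℕℚ k = + k / 1

-- AVG = SUM / COUNT (undefined, i.e. nothing, when COUNT = 0)
avg : ℚ → ℕ → Maybe ℚ
avg s zero    = nothing
avg s (suc c) = just (s ℚ.* (+ 1 / suc c))

record Val : Set where
  constructor mkVal
  field
    count  : ℕ
    countE : ℕ
    vmin   : Maybe ℚ
    vmax   : Maybe ℚ
    vsum   : ℚ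

val0 : Val
val0 = mkVal 0 0 nothing nothing 0ℚ

module Algorithm (G : Graph) (E : ℕ) where
  open Graph G

  isE : ℕ → Bool
  isE v = type v ≡ᵇ E

  -- Pr(j) : predecessor events of j (all of them occur before j)
  preds : ℕ → List ℕ
  preds j = filterᵇ (λ i → edge i j) (upTo j)

  step : ℕ → (ℕ → Val) → Val
  step j f =
    if isE j
      then mkVal c (c ℕ.+ sumℕ (map Val.countE ps))
                 (minM (just (attr j)) (minL (map Val.vmin ps)))
                 (maxM (just (attr j)) (maxL (map Val.vmax ps)))
                 (attr j ℚ.* fromℕℚ c ℚ.+ sumℚ (map Val.vsum ps))
      else mkVal c (sumℕ (map Val.countE ps))
                 (minL (map Val.vmin ps))
                 (maxL (map Val.vmax ps))
                 (sumℚ (map Val.vsum ps))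
    where
      ps : List Val
      ps = map f (preds j)
      -- e.count : number of paths from a START vertex to e
      c : ℕ
      c = (if isStart j then 1 else 0) ℕ.+ sumℕ (map Val.count ps)

  -- values computed in increasing order of time: table k holds the
  -- values of vertices 0 … k-1
  table : ℕ → ℕ → Val
  table zero    i = val0
  table (suc k) i = if i ≡ᵇ k then step k (table k) else table k i

  val : ℕ → Val
  val j = table (suc j) j

  Ends : List ℕ
  Ends = filterᵇ isEnd (upTo n)

  COUNTalg : ℕ
  COUNTalg = sumℕ (map (λ e → Val.countE (val e)) Ends)

  MINalg : Maybe ℚ
  MINalg = minL (map (λ e → Val.vmin (val e)) Ends)

  MAXalg : Maybe ℚ
  MAXalg = maxL (map (λ e → Val.vmax (val e)) Ends)

  SUMalg : ℚ
  SUMalg = sumℚ (map (λ e → Val.vsum (val e)) Ends)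

  AVGalg : Maybe ℚ
  AVGalg = avg SUMalg COUNTalg

  cntE : List ℕ → ℕ
  cntE t = sumℕ (map (λ v → if isE v then 1 else 0) t)

  minE : List ℕ → Maybe ℚ
  minE t = minL (map (λ v → if isE v then just (attr v) else nothing) t)

  maxE : List ℕ → Maybe ℚ
  maxE t = maxL (map (λ v → if isE v then just (attr v) else nothing) t)

  sumE : List ℕ → ℚ
  sumE t = sumℚ (map (λ v → if isE v then attr v else 0ℚ) t)

  COUNTspec : List (List ℕ) → ℕ
  COUNTspec ts = sumℕ (map cntE ts)

  MINspec : List (List ℕ) → Maybe ℚ
  MINspec ts = minL (map minE ts)

  MAXspec : List (List ℕ) → Maybe ℚ
  MAXspec ts = maxL (map maxE ts)

  SUMspec : List (List ℕ) → ℚ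
  SUMspec ts = sumℚ (map sumE ts)

  AVGspec : List (List ℕ) → Maybe ℚ
  AVGspec ts = avg (SUMspec ts) (COUNTspec ts)

module Submission where

-- The value the algorithm stores at a vertex j is the aggregate, over the multiset of paths
-- from a START vertex to j, of a weight that is the monoid unit except on events of type E.
-- These multisets obey the algorithm's recursion: the paths into j are the trivial path (if j
-- is a START vertex) and the paths into each predecessor extended by j.  COUNT, MIN, MAX and
-- SUM are folds over commutative monoids (ℕ and ℚ under +, Maybe ℚ under min and max), so
-- extending k paths by j adds k · w(j); for min and max the monoid is idempotent and k > 0
-- because every vertex lies on a trend.  Summing over the END vertices aggregates over all
-- START–END paths, which are exactly the trends, each listed once.

open import Algebra.Bundles using (CommutativeMonoid)
open import Algebra.Structures using (IsCommutativeMonoid)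
open import Algebra.Structures.Biased using (isCommutativeMonoidˡ)
import Algebra.Properties.CommutativeSemigroup as CommutativeSemigroupProperties
import Algebra.Properties.Monoid.Mult as MonoidMultiplication
open import Data.Bool using (Bool; true; false; T; if_then_else_)
open import Data.Integer as ℤ using (+_)
import Data.Integer.Properties as ℤ
open import Data.List using (List; []; _∷_; [_]; _++_; _∷ʳ_; map; foldr; length; concat; concatMap; upTo)
open import Data.List.Properties using (map-++; length-++; length-map; map-cong; map-cong-local; map-∘; ∷ʳ-injectiveˡ)
open import Data.List.Membership.Propositional using (_∈_; lose; find)
open import Data.List.Membership.Propositional.Properties
  using (∈-map⁺; ∈-map⁻; ∈-++⁺ʳ; ∈-++⁻; ∈-concatMap⁺; ∈-concatMap⁻; ∈-filter⁺; ∈-filter⁻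
        ; ∈-upTo⁺; ∈-upTo⁻)
open import Data.List.Membership.Propositional.Properties.WithK using (unique∧set⇒bag)
open import Data.List.Relation.Binary.BagAndSetEquality using (∼bag⇒↭)
open import Data.List.Relation.Binary.Permutation.Propositional using (_↭_; ↭⇒↭ₛ)
import Data.List.Relation.Binary.Permutation.Propositional.Properties as Permutation
open import Data.List.Relation.Binary.Permutation.Setoid.Properties using (foldr-commMonoid)
open import Data.List.Relation.Unary.All as All using (All; []; _∷_)
import Data.List.Relation.Unary.All.Properties as All
open import Data.List.Relation.Unary.AllPairs as AllPairs using ([]; _∷_)
import Data.List.Relation.Unary.AllPairs.Properties as AllPairs
open import Data.List.Relation.Unary.Any using (here; there)
open import Data.List.Relation.Unary.Linked using (Linked; []; [-]; _∷_)
open import Data.List.Relation.Unary.Unique.Propositional using (Unique)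
import Data.List.Relation.Unary.Unique.Propositional.Properties as Unique
open import Data.Maybe using (Maybe; just; nothing)
open import Data.Nat as ℕ using (ℕ; zero; suc; _+_; _<_; _≡ᵇ_; NonZero)
open import Data.Nat.Induction using (<-wellFounded)
import Data.Nat.Properties as ℕ
open import Data.Product using (_×_; _,_; proj₁; proj₂; ∃-syntax)
open import Data.Rational as ℚ using (ℚ; 0ℚ; 1ℚ; _/_)
import Data.Rational.Properties as ℚ
import Data.Nat.Coprimality as Cop
open import Data.Sum using (_⊎_; inj₁; inj₂)
open import Function using (_∘_)
open import Level using (0ℓ)
open import Function.Bundles using (_⇔_; mk⇔; Equivalence)
open import Induction.WellFounded using (Acc; acc)
open import Relation.Binary.PropositionalEquality.Algebra using (isMagma)
open import Relation.Binary.PropositionalEquality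
  using (_≡_; refl; sym; trans; cong; cong₂; subst; setoid; module ≡-Reasoning)
open import Relation.Nullary.Decidable using (T?)
open import Relation.Nullary.Negation using (¬_)

open import Defs

extendTo : {B C : Set} → B → Bool → (C → List (List B)) → List C → List (List B)
extendTo j start g ps = (if start then [ [ j ] ] else []) ++ concatMap (map (_∷ʳ j) ∘ g) ps

length-extendTo : {B C : Set} (j : B) (s : Bool) (g : C → List (List B)) (ps : List C) →
  length (extendTo j s g ps) ≡ (if s then 1 else 0) + sumℕ (map (length ∘ g) ps)
length-extendTo j s g ps = trans (length-++ (if s then [ [ j ] ] else [])) (cong₂ _+_ (lemma s) (length-extended ps))
  where
  lemma : ∀ s → length (if s then [ [ j ] ] else []) ≡ (if s then 1 else 0)
  lemma true  = refl
  lemma false = refl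
  length-extended : ∀ ps → length (concatMap (map (_∷ʳ j) ∘ g) ps) ≡ sumℕ (map (length ∘ g) ps)
  length-extended []       = refl
  length-extended (p ∷ ps) =
    trans (length-++ (map (_∷ʳ j) (g p))) (cong₂ _+_ (length-map (_∷ʳ j) (g p)) (length-extended ps))

∈⇒length-nonZero : {A : Set} {x : A} {xs : List A} → x ∈ xs → NonZero (length xs)
∈⇒length-nonZero (here _)  = _
∈⇒length-nonZero (there _) = _

unique-concatMap : {A B : Set} {f : A → List B} {xs : List A} → Unique xs → All (Unique ∘ f) xs →
  (∀ {x y v} → v ∈ f x → v ∈ f y → x ≡ y) → Unique (concatMap f xs)
unique-concatMap xs! f! disjoint =
  Unique.concat⁺ (All.map⁺ f!)
    (AllPairs.map⁺ (AllPairs.map (λ x≢y {_} (v∈fx , v∈fy) → x≢y (disjoint v∈fx v∈fy)) xs!))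

module CommutativeFold {A : Set} {_∙_ : A → A → A} {ε : A}
                       (isCommutativeMonoid : IsCommutativeMonoid _≡_ _∙_ ε) where

  commutativeMonoid : CommutativeMonoid 0ℓ 0ℓ
  commutativeMonoid = record { isCommutativeMonoid = isCommutativeMonoid }

  open CommutativeMonoid commutativeMonoid using (assoc; identityˡ; identityʳ; monoid; commutativeSemigroup)
  open CommutativeSemigroupProperties commutativeSemigroup using (interchange; x∙yz≈xz∙y)
  open MonoidMultiplication monoid public using (×-idem) renaming (_×_ to _·_; ×-homo-+ to ·-homo-+)
  open ≡-Reasoning

  fold : List A → A
  fold = foldr _∙_ ε

  fold-++ : ∀ xs ys → fold (xs ++ ys) ≡ fold xs ∙ fold ys
  fold-++ []       ys = sym (identityˡ _)
  fold-++ (x ∷ xs) ys = trans (cong (x ∙_) (fold-++ xs ys)) (sym (assoc x _ _))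

  fold-↭ : ∀ {xs ys} → xs ↭ ys → fold xs ≡ fold ys
  fold-↭ p = foldr-commMonoid (setoid A) isCommutativeMonoid (↭⇒↭ₛ p)

  fold-map-∙ : {B : Set} (f g : B → A) (xs : List B) →
    fold (map (λ x → f x ∙ g x) xs) ≡ fold (map f xs) ∙ fold (map g xs)
  fold-map-∙ f g []       = sym (identityˡ ε)
  fold-map-∙ f g (x ∷ xs) = trans (cong ((f x ∙ g x) ∙_) (fold-map-∙ f g xs)) (interchange _ _ _ _)

  fold-map-· : {B : Set} (n : B → ℕ) (a : A) (xs : List B) →
    fold (map (λ x → n x · a) xs) ≡ sumℕ (map n xs) · a
  fold-map-· n a []       = refl
  fold-map-· n a (x ∷ xs) = trans (cong ((n x · a) ∙_) (fold-map-· n a xs)) (sym (·-homo-+ a (n x) _))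

  ·-ε : ∀ n → n · ε ≡ ε
  ·-ε zero    = refl
  ·-ε (suc n) = trans (identityˡ _) (·-ε n)

  module _ {B : Set} (w : B → A) where

    -- COUNTspec, MINspec, MAXspec and SUMspec are definitionally instances of Agg.
    Agg : List (List B) → A
    Agg = fold ∘ map (fold ∘ map w)

    Agg-↭ : ∀ {M N} → M ↭ N → Agg M ≡ Agg N
    Agg-↭ p = fold-↭ (Permutation.map⁺ (fold ∘ map w) p)

    Agg-++ : ∀ M N → Agg (M ++ N) ≡ Agg M ∙ Agg N
    Agg-++ M N = trans (cong fold (map-++ (fold ∘ map w) M N)) (fold-++ (map (fold ∘ map w) M) _)

    Agg-concatMap : {C : Set} (f : C → List (List B)) (xs : List C) → Agg (concatMap f xs) ≡ fold (map (Agg ∘ f) xs)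
    Agg-concatMap f []       = refl
    Agg-concatMap f (x ∷ xs) = trans (Agg-++ (f x) _) (cong (Agg (f x) ∙_) (Agg-concatMap f xs))

    fold-map-∷ʳ : ∀ q j → fold (map w (q ∷ʳ j)) ≡ fold (map w q) ∙ w j
    fold-map-∷ʳ q j =
      trans (cong fold (map-++ w q [ j ]))
            (trans (fold-++ (map w q) [ w j ]) (cong (fold (map w q) ∙_) (identityʳ (w j))))

    Agg-map-∷ʳ : ∀ j M → Agg (map (_∷ʳ j) M) ≡ Agg M ∙ (length M · w j)
    Agg-map-∷ʳ j []      = sym (identityˡ ε)
    Agg-map-∷ʳ j (q ∷ M) = trans (cong₂ _∙_ (fold-map-∷ʳ q j) (Agg-map-∷ʳ j M)) (interchange _ _ _ _)

    Agg-start : ∀ s j → Agg (if s then [ [ j ] ] else []) ≡ (if s then 1 else 0) · w j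
    Agg-start true  j = identityʳ (w j ∙ ε)
    Agg-start false j = refl

    Agg-extendTo : {C : Set} (j : B) (s : Bool) (g : C → List (List B)) (ps : List C) →
      Agg (extendTo j s g ps) ≡ (length (extendTo j s g ps) · w j) ∙ fold (map (Agg ∘ g) ps)
    Agg-extendTo j s g ps = begin
      Agg (extendTo j s g ps)
        ≡⟨ Agg-++ (if s then [ [ j ] ] else []) _ ⟩
      Agg (if s then [ [ j ] ] else []) ∙ Agg (concatMap (map (_∷ʳ j) ∘ g) ps)
        ≡⟨ cong₂ _∙_ (Agg-start s j) (Agg-concatMap (map (_∷ʳ j) ∘ g) ps) ⟩
      (start · w j) ∙ fold (map (Agg ∘ map (_∷ʳ j) ∘ g) ps)
        ≡⟨ cong (λ xs → _ ∙ fold xs) (map-cong (λ p → Agg-map-∷ʳ j (g p)) ps) ⟩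
      (start · w j) ∙ fold (map (λ p → Agg (g p) ∙ (length (g p) · w j)) ps)
        ≡⟨ cong (_ ∙_) (trans (fold-map-∙ (Agg ∘ g) _ ps)
                              (cong (_ ∙_) (fold-map-· (length ∘ g) (w j) ps))) ⟩
      (start · w j) ∙ (fold (map (Agg ∘ g) ps) ∙ (sumℕ (map (length ∘ g) ps) · w j))
        ≡⟨ x∙yz≈xz∙y _ _ _ ⟩
      ((start · w j) ∙ (sumℕ (map (length ∘ g) ps) · w j)) ∙ fold (map (Agg ∘ g) ps)
        ≡⟨ cong (_∙ _) (sym (·-homo-+ (w j) start _)) ⟩
      ((start + sumℕ (map (length ∘ g) ps)) · w j) ∙ fold (map (Agg ∘ g) ps)
        ≡⟨ cong (λ n → (n · w j) ∙ _) (sym (length-extendTo j s g ps)) ⟩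
      (length (extendTo j s g ps) · w j) ∙ fold (map (Agg ∘ g) ps) ∎
      where
      start : ℕ
      start = if s then 1 else 0

    fold-map≡Agg-↭ : {C : Set} (a : C → A) (f : C → List (List B)) (xs : List C) {N : List (List B)} →
      All (λ x → a x ≡ Agg (f x)) xs → concatMap f xs ↭ N → fold (map a xs) ≡ Agg N
    fold-map≡Agg-↭ a f xs a≡ p = trans (cong fold (map-cong-local a≡)) (trans (sym (Agg-concatMap f xs)) (Agg-↭ p))

module ℕ-Fold = CommutativeFold ℕ.+-0-isCommutativeMonoid
module ℚ-Fold = CommutativeFold ℚ.+-0-isCommutativeMonoid

minM-assoc : ∀ x y z → minM (minM x y) z ≡ minM x (minM y z)
minM-assoc nothing  y        z        = refl
minM-assoc (just x) nothing  z        = refl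
minM-assoc (just x) (just y) nothing  = refl
minM-assoc (just x) (just y) (just z) = cong just (ℚ.⊓-assoc x y z)

minM-comm : ∀ x y → minM x y ≡ minM y x
minM-comm nothing  nothing  = refl
minM-comm nothing  (just y) = refl
minM-comm (just x) nothing  = refl
minM-comm (just x) (just y) = cong just (ℚ.⊓-comm x y)

minM-idem : ∀ x → minM x x ≡ x
minM-idem nothing  = refl
minM-idem (just x) = cong just (ℚ.⊓-idem x)

maxM-assoc : ∀ x y z → maxM (maxM x y) z ≡ maxM x (maxM y z)
maxM-assoc nothing  y        z        = refl
maxM-assoc (just x) nothing  z        = refl
maxM-assoc (just x) (just y) nothing  = refl
maxM-assoc (just x) (just y) (just z) = cong just (ℚ.⊔-assoc x y z)

maxM-comm : ∀ x y → maxM x y ≡ maxM y x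
maxM-comm nothing  nothing  = refl
maxM-comm nothing  (just y) = refl
maxM-comm (just x) nothing  = refl
maxM-comm (just x) (just y) = cong just (ℚ.⊔-comm x y)

maxM-idem : ∀ x → maxM x x ≡ x
maxM-idem nothing  = refl
maxM-idem (just x) = cong just (ℚ.⊔-idem x)

minM-isCommutativeMonoid : IsCommutativeMonoid _≡_ minM nothing
minM-isCommutativeMonoid = isCommutativeMonoidˡ record
  { isSemigroup = record { isMagma = isMagma minM ; assoc = minM-assoc }
  ; identityˡ   = λ _ → refl
  ; comm        = minM-comm
  }

maxM-isCommutativeMonoid : IsCommutativeMonoid _≡_ maxM nothing
maxM-isCommutativeMonoid = isCommutativeMonoidˡ record
  { isSemigroup = record { isMagma = isMagma maxM ; assoc = maxM-assoc }
  ; identityˡ   = λ _ → refl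
  ; comm        = maxM-comm
  }

module Min-Fold = CommutativeFold minM-isCommutativeMonoid
module Max-Fold = CommutativeFold maxM-isCommutativeMonoid

·-1 : ∀ c → c ℕ-Fold.· 1 ≡ c
·-1 zero    = refl
·-1 (suc c) = cong suc (·-1 c)

fromℕℚ-suc : ∀ k → fromℕℚ (suc k) ≡ 1ℚ ℚ.+ fromℕℚ k
fromℕℚ-suc k rewrite ℚ.normalize-coprime {k} {0} (Cop.sym (Cop.1-coprimeTo k)) =
  cong (_/ 1) (cong (ℤ._+_ (+ 1)) (sym (ℤ.*-identityʳ (+ k))))

·-fromℕℚ : ∀ c a → c ℚ-Fold.· a ≡ a ℚ.* fromℕℚ c
·-fromℕℚ zero    a = sym (ℚ.*-zeroʳ a)
·-fromℕℚ (suc c) a = begin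
  a ℚ.+ c ℚ-Fold.· a             ≡⟨ cong₂ ℚ._+_ (sym (ℚ.*-identityʳ a)) (·-fromℕℚ c a) ⟩
  a ℚ.* 1ℚ ℚ.+ a ℚ.* fromℕℚ c   ≡⟨ sym (ℚ.*-distribˡ-+ a 1ℚ (fromℕℚ c)) ⟩
  a ℚ.* (1ℚ ℚ.+ fromℕℚ c)       ≡⟨ cong (a ℚ.*_) (sym (fromℕℚ-suc c)) ⟩
  a ℚ.* fromℕℚ (suc c)          ∎
  where open ≡-Reasoning

module _ {B C : Set} {j : B} {g : C → List (List B)} {ps : List C} where

  ∈-extendTo⁺ˡ : ∀ {s} → T s → [ j ] ∈ extendTo j s g ps
  ∈-extendTo⁺ˡ {true} _ = here refl

  ∈-extendTo⁺ʳ : ∀ {s p q} → p ∈ ps → q ∈ g p → q ∷ʳ j ∈ extendTo j s g ps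
  ∈-extendTo⁺ʳ {s} p∈ps q∈gp = ∈-++⁺ʳ (if s then [ [ j ] ] else [])
    (∈-concatMap⁺ (map (_∷ʳ j) ∘ g) (lose p∈ps (∈-map⁺ (_∷ʳ j) q∈gp)))

  ∈-extendTo⁻ : ∀ {s q} → q ∈ extendTo j s g ps →
    (q ≡ [ j ] × T s) ⊎ ∃[ p ] ∃[ q′ ] (p ∈ ps × q′ ∈ g p × q ≡ q′ ∷ʳ j)
  ∈-extendTo⁻ {s} q∈ with ∈-++⁻ (if s then [ [ j ] ] else []) q∈
  ∈-extendTo⁻ {true} _ | inj₁ (here refl) = inj₁ (refl , _)
  ∈-extendTo⁻ _ | inj₂ q∈ext with find (∈-concatMap⁻ (map (_∷ʳ j) ∘ g) {xs = ps} q∈ext)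
  ... | p , p∈ps , q∈ with ∈-map⁻ (_∷ʳ j) q∈
  ...   | q′ , q′∈gp , refl = inj₂ (p , q′ , p∈ps , q′∈gp , refl)

  unique-extendTo : ∀ s → Unique ps → All (Unique ∘ g) ps → (∀ {p} → ¬ [] ∈ g p) →
    (∀ {x y q} → q ∈ g x → q ∈ g y → x ≡ y) → Unique (extendTo j s g ps)
  unique-extendTo s ps! g! []∉g disjoint =
    Unique.++⁺ (start! s)
      (unique-concatMap ps! (All.map (Unique.map⁺ (∷ʳ-injectiveˡ _ _)) g!) disjoint-extended)
      (start∉extended s)
    where
    start! : ∀ s → Unique (if s then [ [ j ] ] else [])
    start! true  = [] ∷ []
    start! false = []
    disjoint-extended : ∀ {x y v} → v ∈ map (_∷ʳ j) (g x) → v ∈ map (_∷ʳ j) (g y) → x ≡ y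
    disjoint-extended v∈x v∈y with ∈-map⁻ (_∷ʳ j) v∈x | ∈-map⁻ (_∷ʳ j) v∈y
    ... | q , q∈gx , refl | q′ , q′∈gy , eq =
      disjoint q∈gx (subst (_∈ _) (sym (∷ʳ-injectiveˡ _ _ eq)) q′∈gy)
    start∉extended : ∀ s {v} → ¬ (v ∈ (if s then [ [ j ] ] else []) × v ∈ concatMap (map (_∷ʳ j) ∘ g) ps)
    start∉extended true (here refl , []∷ʳj∈ext) with ∈-extendTo⁻ {s = false} []∷ʳj∈ext
    ... | inj₂ (_ , q , _ , q∈gp , eq) = []∉g (subst (_∈ _) (sym (∷ʳ-injectiveˡ [] _ eq)) q∈gp)

module Paths (G : Graph) where
  open Graph G

  data Path : ℕ → ℕ → List ℕ → Set where
    trivial : ∀ i → Path i i [ i ]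
    _▷_     : ∀ {i p j q} → Path i p q → Edge G p j → Path i j (q ∷ʳ j)

  prepend : ∀ {v i j q} → Edge G v i → Path i j q → Path v j (v ∷ q)
  prepend e (trivial i) = trivial _ ▷ e
  prepend e (π ▷ e′)    = prepend e π ▷ e′

  linked⇒path : ∀ v vs → Linked (Edge G) (v ∷ vs) → Path v (lastOf G v vs) (v ∷ vs)
  linked⇒path v []       [-]     = trivial v
  linked⇒path v (w ∷ ws) (e ∷ l) = prepend e (linked⇒path w ws l)

  lastOf-∷ʳ : ∀ v vs j → lastOf G v (vs ∷ʳ j) ≡ j
  lastOf-∷ʳ v []       j = refl
  lastOf-∷ʳ v (w ∷ ws) j = lastOf-∷ʳ w ws j

  lastOf-∈ : ∀ v vs → lastOf G v vs ∈ v ∷ vs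
  lastOf-∈ v []       = here refl
  lastOf-∈ v (w ∷ ws) = there (lastOf-∈ w ws)

  linked-∷ʳ : ∀ v vs {j} → Linked (Edge G) (v ∷ vs) → Edge G (lastOf G v vs) j →
    Linked (Edge G) (v ∷ vs ∷ʳ j)
  linked-∷ʳ v []       [-]      e = e ∷ [-]
  linked-∷ʳ v (w ∷ ws) (e′ ∷ l) e = e′ ∷ linked-∷ʳ w ws l e

  path⇒linked : ∀ {i j q} → Path i j q →
    ∃[ vs ] (q ≡ i ∷ vs × lastOf G i vs ≡ j × Linked (Edge G) (i ∷ vs))
  path⇒linked (trivial i) = [] , refl , refl , [-]
  path⇒linked (π ▷ e) with path⇒linked π
  ... | vs , refl , refl , l = vs ∷ʳ _ , refl , lastOf-∷ʳ _ vs _ , linked-∷ʳ _ vs l e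

  path-nonEmpty : ∀ {i j} → ¬ Path i j []
  path-nonEmpty π with path⇒linked π
  ... | _ , () , _

  path-end-unique : ∀ {i i′ j j′ q} → Path i j q → Path i′ j′ q → j ≡ j′
  path-end-unique π π′ with path⇒linked π | path⇒linked π′
  ... | vs , refl , refl , _ | .vs , refl , refl , _ = refl

  path-bounded : ∀ {i j q} → Path i j q → j < n → All (_< n) q
  path-bounded (trivial i) j<n = j<n ∷ []
  path-bounded (π ▷ e)     j<n = All.++⁺ (path-bounded π (ℕ.<-trans (edge-forward e) j<n)) (j<n ∷ [])

  linked⇒path-to-∈ : ∀ {u us v} → Linked (Edge G) (u ∷ us) → v ∈ u ∷ us → ∃[ q ] Path u v q
  linked⇒path-to-∈ _ (here refl) = _ , trivial _
  linked⇒path-to-∈ {us = w ∷ ws} (e ∷ l) (there v∈) with linked⇒path-to-∈ l v∈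
  ... | q , π = _ , prepend e π

  StartPath : ℕ → List ℕ → Set
  StartPath j q = ∃[ i ] (T (isStart i) × Path i j q)

  startPath⇒trend : ∀ {j q} → T (isEnd j) → j < n → StartPath j q → IsTrend G q
  startPath⇒trend end j<n (i , start , π) with path⇒linked π
  ... | vs , refl , refl , l = start , end , path-bounded π j<n , l

  trend⇒startPath : ∀ t → IsTrend G t → ∃[ j ] (j < n × T (isEnd j) × StartPath j t)
  trend⇒startPath (v ∷ vs) (start , end , bounded , l) =
    lastOf G v vs , All.lookup bounded (lastOf-∈ v vs) , end , v , start , linked⇒path v vs l

module Correctness (G : Graph) (E : ℕ) where
  open Graph G
  open Algorithm G E
  open Paths G

  preds⁻ : ∀ {p j} → p ∈ preds j → Edge G p j
  preds⁻ {p} {j} p∈ = proj₂ (∈-filter⁻ (T? ∘ (λ i → edge i j)) {xs = upTo j} p∈)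

  preds⁺ : ∀ {p j} → Edge G p j → p ∈ preds j
  preds⁺ {p} {j} e = ∈-filter⁺ (T? ∘ (λ i → edge i j)) (∈-upTo⁺ (edge-forward e)) e

  preds-unique : ∀ j → Unique (preds j)
  preds-unique j = Unique.filter⁺ (T? ∘ (λ i → edge i j)) (Unique.upTo⁺ j)

  -- Built by the same recursion as table, so that the two can be compared entry by entry.
  pathTable : ℕ → ℕ → List (List ℕ)
  pathTable zero    i = []
  pathTable (suc k) i = if i ≡ᵇ k then extendTo k (isStart k) (pathTable k) (preds k) else pathTable k i

  paths : ℕ → List (List ℕ)
  paths j = pathTable (suc j) j

  paths-pathTable : ∀ j → paths j ≡ extendTo j (isStart j) (pathTable j) (preds j)
  paths-pathTable j with j ≡ᵇ j | ℕ.≡⇒≡ᵇ j j refl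
  ... | true | _ = refl

  pathTable-stable : ∀ {k i} → i < k → pathTable k i ≡ paths i
  pathTable-stable {suc k} {i} i<k with i ≡ᵇ k | ℕ.≡ᵇ⇒≡ i k | ℕ.≡⇒≡ᵇ i k
  ... | true  | i≡k | _ with refl ← i≡k _ = sym (paths-pathTable i)
  ... | false | _   | i≢k = pathTable-stable (ℕ.≤∧≢⇒< (ℕ.≤-pred i<k) i≢k)

  paths-unfold : ∀ j → paths j ≡ extendTo j (isStart j) paths (preds j)
  paths-unfold j = trans (paths-pathTable j)
    (cong (λ xss → (if isStart j then [ [ j ] ] else []) ++ concat xss) (map-cong-local {xs = preds j}
      (All.tabulate λ p∈ → cong (map (_∷ʳ j)) (pathTable-stable (edge-forward (preds⁻ {j = j} p∈))))))

  ∈paths⇒startPath : ∀ {j q} → q ∈ paths j → StartPath j q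
  ∈paths⇒startPath {j} = go (<-wellFounded j)
    where
    go : ∀ {j q} → Acc _<_ j → q ∈ paths j → StartPath j q
    go {j} (acc rec) q∈ with ∈-extendTo⁻ {j = j} {g = paths} {ps = preds j} (subst (_ ∈_) (paths-unfold j) q∈)
    ... | inj₁ (refl , start) = j , start , trivial j
    ... | inj₂ (p , q′ , p∈ , q′∈ , refl) with go (rec (edge-forward (preds⁻ p∈))) q′∈
    ...   | i , start , π = i , start , π ▷ preds⁻ p∈

  startPath⇒∈paths : ∀ {j q} → StartPath j q → q ∈ paths j
  startPath⇒∈paths (i , start , trivial i) =
    subst (_ ∈_) (sym (paths-unfold i)) (∈-extendTo⁺ˡ {g = paths} {ps = preds i} start)
  startPath⇒∈paths {j} (i , start , π ▷ e) =
    subst (_ ∈_) (sym (paths-unfold j))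
      (∈-extendTo⁺ʳ {j = j} {g = paths} (preds⁺ e) (startPath⇒∈paths (i , start , π)))

  []∉paths : ∀ {j} → ¬ [] ∈ paths j
  []∉paths {j} []∈ = let _ , _ , π = ∈paths⇒startPath {j} []∈ in path-nonEmpty π

  paths-disjoint : ∀ {x y q} → q ∈ paths x → q ∈ paths y → x ≡ y
  paths-disjoint {x} {y} q∈x q∈y = let _ , _ , π = ∈paths⇒startPath {x} q∈x
                                       _ , _ , π′ = ∈paths⇒startPath {y} q∈y
                                   in path-end-unique π π′

  paths-unique : ∀ j → Unique (paths j)
  paths-unique j = go (<-wellFounded j)
    where
    go : ∀ {j} → Acc _<_ j → Unique (paths j)
    go {j} (acc rec) = subst Unique (sym (paths-unfold j))
      (unique-extendTo {j = j} {g = paths} (isStart j) (preds-unique j)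
        (All.tabulate λ {p} p∈ → go {p} (rec (edge-forward (preds⁻ p∈))))
        (λ {p} → []∉paths {p}) (λ {x} {y} → paths-disjoint {x} {y}))

  reachable⇒paths-nonZero : ∀ {v} → ∃[ t ] (IsTrend G t × v ∈ t) → NonZero (length (paths v))
  reachable⇒paths-nonZero (u ∷ us , (start , _ , _ , l) , v∈t) =
    ∈⇒length-nonZero (startPath⇒∈paths (u , start , proj₂ (linked⇒path-to-∈ l v∈t)))

  Ends⁻ : ∀ {e} → e ∈ Ends → e < n × T (isEnd e)
  Ends⁻ e∈ with ∈-filter⁻ (T? ∘ isEnd) {xs = upTo n} e∈
  ... | e∈upTo , end = ∈-upTo⁻ e∈upTo , end

  Ends⁺ : ∀ {e} → e < n → T (isEnd e) → e ∈ Ends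
  Ends⁺ e<n end = ∈-filter⁺ (T? ∘ isEnd) (∈-upTo⁺ e<n) end

  trends : List (List ℕ)
  trends = concatMap paths Ends

  ∈trends⇔isTrend : ∀ t → t ∈ trends ⇔ IsTrend G t
  ∈trends⇔isTrend t = mk⇔ to from
    where
    to : t ∈ trends → IsTrend G t
    to t∈ with find (∈-concatMap⁻ paths {xs = Ends} t∈)
    ... | e , e∈ , t∈paths =
      startPath⇒trend (proj₂ (Ends⁻ e∈)) (proj₁ (Ends⁻ e∈)) (∈paths⇒startPath t∈paths)
    from : IsTrend G t → t ∈ trends
    from trend with trend⇒startPath t trend
    ... | e , e<n , end , π = ∈-concatMap⁺ paths (lose (Ends⁺ e<n end) (startPath⇒∈paths π))

  trends-unique : Unique trends
  trends-unique = unique-concatMap (Unique.filter⁺ (T? ∘ isEnd) (Unique.upTo⁺ n))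
    (All.tabulate λ {e} _ → paths-unique e)
    (λ {x} {y} → paths-disjoint {x} {y})

  trends-↭ : ∀ {ts} → Unique ts → (∀ t → t ∈ ts ⇔ IsTrend G t) → trends ↭ ts
  trends-↭ ts! ts⇔ = ∼bag⇒↭ (unique∧set⇒bag trends-unique ts! λ {t} →
    mk⇔ (Equivalence.from (ts⇔ t) ∘ Equivalence.to (∈trends⇔isTrend t))
        (Equivalence.from (∈trends⇔isTrend t) ∘ Equivalence.to (ts⇔ t)))

  wCount : ℕ → ℕ
  wCount v = if isE v then 1 else 0

  wAttr : ℕ → ℚ
  wAttr v = if isE v then attr v else 0ℚ

  wBound : ℕ → Maybe ℚ
  wBound v = if isE v then just (attr v) else nothing

  startCount : ℕ → ℕ
  startCount j = if isStart j then 1 else 0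

  pathCount : ℕ → (ℕ → Val) → ℕ
  pathCount j f = startCount j + sumℕ (map Val.count (map f (preds j)))

  count-step : ∀ j f → Val.count (step j f) ≡ pathCount j f
  count-step j f with isE j
  ... | true  = refl
  ... | false = refl

  countE-step : ∀ j f →
    Val.countE (step j f) ≡ pathCount j f ℕ-Fold.· wCount j + sumℕ (map Val.countE (map f (preds j)))
  countE-step j f with isE j
  ... | true  = cong (_+ sumℕ (map Val.countE (map f (preds j)))) (sym (·-1 (pathCount j f)))
  ... | false = cong (_+ sumℕ (map Val.countE (map f (preds j)))) (sym (ℕ-Fold.·-ε (pathCount j f)))

  vsum-step : ∀ j f →
    Val.vsum (step j f) ≡ pathCount j f ℚ-Fold.· wAttr j ℚ.+ sumℚ (map Val.vsum (map f (preds j)))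
  vsum-step j f with isE j
  ... | true  = cong (ℚ._+ sumℚ (map Val.vsum (map f (preds j)))) (sym (·-fromℕℚ (pathCount j f) (attr j)))
  ... | false = sym (trans (cong (ℚ._+ sumℚ (map Val.vsum (map f (preds j)))) (ℚ-Fold.·-ε (pathCount j f)))
                           (ℚ.+-identityˡ _))

  -- The minimum and maximum are idempotent, so the multiplicity k of the new vertex only needs to be positive.
  vmin-step : ∀ j f k .{{_ : NonZero k}} →
    Val.vmin (step j f) ≡ minM (k Min-Fold.· wBound j) (minL (map Val.vmin (map f (preds j))))
  vmin-step j f k with isE j
  ... | true  = cong (λ x → minM x (minL (map Val.vmin (map f (preds j)))))
                     (sym (Min-Fold.×-idem (minM-idem (just (attr j))) k))
  ... | false = cong (λ x → minM x (minL (map Val.vmin (map f (preds j))))) (sym (Min-Fold.·-ε k))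

  vmax-step : ∀ j f k .{{_ : NonZero k}} →
    Val.vmax (step j f) ≡ maxM (k Max-Fold.· wBound j) (maxL (map Val.vmax (map f (preds j))))
  vmax-step j f k with isE j
  ... | true  = cong (λ x → maxM x (maxL (map Val.vmax (map f (preds j)))))
                     (sym (Max-Fold.×-idem (maxM-idem (just (attr j))) k))
  ... | false = cong (λ x → maxM x (maxL (map Val.vmax (map f (preds j))))) (sym (Max-Fold.·-ε k))

  record _Summarises_ (v : Val) (M : List (List ℕ)) : Set where
    field
      count  : Val.count v ≡ length M
      countE : Val.countE v ≡ COUNTspec M
      vmin   : Val.vmin v ≡ MINspec M
      vmax   : Val.vmax v ≡ MAXspec M
      vsum   : Val.vsum v ≡ SUMspec M

  val0-summarises-[] : val0 Summarises []
  val0-summarises-[] = record { count = refl ; countE = refl ; vmin = refl ; vmax = refl ; vsum = refl }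

  step-summarises : ∀ j f g → All (λ p → f p Summarises g p) (preds j) →
    .{{_ : NonZero (length (extendTo j (isStart j) g (preds j)))}} →
    step j f Summarises extendTo j (isStart j) g (preds j)
  step-summarises j f g hyp = record
    { count  = trans (count-step j f) pathCount≡
    ; countE = trans (countE-step j f)
        (trans (cong₂ (λ c xs → c ℕ-Fold.· wCount j + sumℕ xs) pathCount≡ (agree _Summarises_.countE))
               (sym (ℕ-Fold.Agg-extendTo wCount j (isStart j) g ps)))
    ; vmin   = trans (vmin-step j f (length M))
        (trans (cong (minM (length M Min-Fold.· wBound j) ∘ minL) (agree _Summarises_.vmin))
               (sym (Min-Fold.Agg-extendTo wBound j (isStart j) g ps)))
    ; vmax   = trans (vmax-step j f (length M))
        (trans (cong (maxM (length M Max-Fold.· wBound j) ∘ maxL) (agree _Summarises_.vmax))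
               (sym (Max-Fold.Agg-extendTo wBound j (isStart j) g ps)))
    ; vsum   = trans (vsum-step j f)
        (trans (cong₂ (λ c xs → c ℚ-Fold.· wAttr j ℚ.+ sumℚ xs) pathCount≡ (agree _Summarises_.vsum))
               (sym (ℚ-Fold.Agg-extendTo wAttr j (isStart j) g ps)))
    }
    where
    ps : List ℕ
    ps = preds j
    M : List (List ℕ)
    M = extendTo j (isStart j) g ps
    agree : {X : Set} {π : Val → X} {σ : List (List ℕ) → X} →
      (∀ {v N} → v Summarises N → π v ≡ σ N) → map π (map f ps) ≡ map (σ ∘ g) ps
    agree h = trans (sym (map-∘ ps)) (map-cong-local (All.map h hyp))
    pathCount≡ : pathCount j f ≡ length M
    pathCount≡ = trans (cong (λ xs → startCount j + sumℕ xs) (agree _Summarises_.count))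
                       (sym (length-extendTo j (isStart j) g ps))

  table-summarises : (∀ v → v < n → ∃[ t ] (IsTrend G t × v ∈ t)) →
    ∀ k {i} → i < n → table k i Summarises pathTable k i
  table-summarises reach zero          i<n = val0-summarises-[]
  table-summarises reach (suc k) {i} i<n with i ≡ᵇ k | ℕ.≡ᵇ⇒≡ i k
  ... | false | _   = table-summarises reach k i<n
  ... | true  | i≡k with refl ← i≡k _ =
    step-summarises i (table i) (pathTable i)
      (All.tabulate λ p∈ → table-summarises reach i (ℕ.<-trans (edge-forward (preds⁻ p∈)) i<n))
      {{subst (NonZero ∘ length) (paths-pathTable i) (reachable⇒paths-nonZero (reach i i<n))}}

theorem8 : (G : Graph) (E : ℕ)
    → (∀ v → v < Graph.n G → ∃[ t ] (IsTrend G t × v ∈ t))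
    → (ts : List (List ℕ)) → Unique ts → (∀ t → (t ∈ ts) ⇔ IsTrend G t)
    → (Algorithm.COUNTalg G E ≡ Algorithm.COUNTspec G E ts)
      × (Algorithm.MINalg G E ≡ Algorithm.MINspec G E ts)
      × (Algorithm.MAXalg G E ≡ Algorithm.MAXspec G E ts)
      × (Algorithm.SUMalg G E ≡ Algorithm.SUMspec G E ts)
      × (Algorithm.AVGalg G E ≡ Algorithm.AVGspec G E ts)
theorem8 G E reach ts ts! ts⇔ = count≡ , min≡ , max≡ , sum≡ , cong₂ avg sum≡ count≡
  where
  open Algorithm G E
  open Correctness G E

  summaries : All (λ e → val e Summarises paths e) Ends
  summaries = All.tabulate λ {e} e∈ → table-summarises reach (suc e) (proj₁ (Ends⁻ e∈))

  trends↭ts : trends ↭ ts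
  trends↭ts = trends-↭ ts! ts⇔

  count≡ : COUNTalg ≡ COUNTspec ts
  count≡ = ℕ-Fold.fold-map≡Agg-↭ wCount _ paths Ends (All.map _Summarises_.countE summaries) trends↭ts

  min≡ : MINalg ≡ MINspec ts
  min≡ = Min-Fold.fold-map≡Agg-↭ wBound _ paths Ends (All.map _Summarises_.vmin summaries) trends↭ts

  max≡ : MAXalg ≡ MAXspec ts
  max≡ = Max-Fold.fold-map≡Agg-↭ wBound _ paths Ends (All.map _Summarises_.vmax summaries) trends↭ts

  sum≡ : SUMalg ≡ SUMspec ts
  sum≡ = ℚ-Fold.fold-map≡Agg-↭ wAttr _ paths Ends (All.map _Summarises_.vsum summaries) trends↭ts
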